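{- Let $G$ be a nontrivial finite group of odd order. Then the nim-number of the achievement game $\mathsf{GEN}(G)$ is $1$ or $2$.
   Context: For a finite group $G$, the achievement game $\mathsf{GEN}(G)$ is the impartial game (normal play: a player with no available move loses) with starting position $\emptyset$, whose positions are $\emptyset$, the subsets $P\subseteq G$ with $\langle P\rangle\neq G$, and the subsets $P\subseteq G$ with $\langle P\rangle=G$ such that $\langle P\setminus\{s\}\rangle\neq G$ for some $s\in P$. If $\langle P\rangle\neq G$, the options of $P$ are $\operatorname{Opt}(P)=\{P\cup\{g\}: g\in G\setminus P\}$; if $\langle P\rangle=G$, then $\operatorname{Opt}(P)=\emptyset$. The nim-number is defined recursively by $\operatorname{nim}(P)=\operatorname{mex}\{\operatorname{nim}(Q):Q\in\operatorname{Opt}(P)\}$, where $\operatorname{mex}(A)$ is the least nonnegative integer not in $A$; the nim-number of the game is $\operatorname{nim}(\emptyset)$. -}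

module Defs where

open import Data.Nat using (ℕ; zero; suc)
open import Data.Nat.Properties using (_≟_)
open import Data.Bool using (Bool; true; false; if_then_else_)
import Data.Bool
open import Data.Fin using (Fin)
open import Data.Fin.Subset using (Subset; _∈_; _∪_; ⁅_⁆) renaming (⊥ to ∅)
open import Data.List using (List; []; _∷_; length; map; filter) renaming (allFin to allFinL)
open import Data.List.Membership.DecPropositional _≟_ using (_∈?_)
open import Data.Vec using (lookup)
open import Relation.Nullary using (Dec; yes; no; ¬_)
open import Relation.Binary.PropositionalEquality using (_≡_)
open import Relation.Nullary.Decidable using (does)

-- mex of a finite list of naturals: least natural number not in the list.
-- (The search is bounded by length+1 steps, which always suffices.)
mex : List ℕ → ℕ
mex xs = go (suc (length xs)) 0
  where
  go : ℕ → ℕ → ℕ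
  go zero m = m
  go (suc f) m = if does (m ∈? xs) then go f (suc m) else m

-- A finite group of order n is presented on the carrier Fin n with
-- propositional equality, operation _∙_, identity ε and inverse _⁻¹
-- (the group laws are imposed separately via IsGroup in the statement).
module Game {n : ℕ} (_∙_ : Fin n → Fin n → Fin n) (ε : Fin n) (_⁻¹ : Fin n → Fin n) where

  data _∈⟨_⟩ : Fin n → Subset n → Set where
    gen : ∀ {P g} → g ∈ P → g ∈⟨ P ⟩
    one : ∀ {P} → ε ∈⟨ P ⟩
    mul : ∀ {P g h} → g ∈⟨ P ⟩ → h ∈⟨ P ⟩ → (g ∙ h) ∈⟨ P ⟩
    inv : ∀ {P g} → g ∈⟨ P ⟩ → (g ⁻¹) ∈⟨ P ⟩

  Generates : Subset n → Set
  Generates P = ∀ g → g ∈⟨ P ⟩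

  -- nim-numbers of GEN(G), given a decision procedure for generation.
  -- The value does not depend on which decision procedure is supplied.
  module _ (gen? : (P : Subset n) → Dec (Generates P)) where

    nimF : ℕ → Subset n → ℕ
    nimF f P with gen? P
    ... | yes _ = 0
    nimF zero P | no _ = 0
    nimF (suc f) P | no _ =
      mex (map (λ g → nimF f (P ∪ ⁅ g ⁆))
               (filter (λ g → ¬? (lookup P g)) (allFinL n)))
      where
      ¬? : (b : Bool) → Dec (b ≡ false)
      ¬? = λ b → b Data.Bool.≟ false

    -- nim-number of the game GEN(G) (start position ∅); from ∅ at most n
    -- moves can be made, after which the whole group is chosen.
    nimGEN : ℕ
    nimGEN = nimF n ∅

-- In a group of odd order ε is the only self-inverse element (right multiplication by any
-- other one would pair off the elements of G), so pairing x with x⁻¹ shows that every set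
-- containing ε and closed under inversion has odd size.  Hence a non-generating position P
-- of even size has a move h ∉ P with h ∈ ⟨P⟩, which does not change ⟨P⟩.  By induction on
-- the number of remaining moves, a non-generating position of odd size has nim-number 1 if
-- some move generates G and 0 otherwise, while one of even size has nim-number 1 or 2, and
-- 2 if some move generates G: every option of an even position has nim-number 0 or 1, and
-- the option P ∪ {h} has nim-number 1 exactly when P has a generating move.  The start
-- position ∅ has even size.
module Submission where

open import Defs
open import Data.Nat using (ℕ; zero; suc; _≤_; _<_; _+_; s≤s)
open import Data.Nat.Divisibility using (_∣_; _∣0; ∣-refl; ∣m∣n⇒∣m+n; ∣m+n∣m⇒∣n; ∣1⇒≡1)
open import Data.Nat.Induction using (<-wellFounded)
open import Data.Nat.Properties using (+-comm; +-suc; +-identityʳ; ≤-refl; ≤-antisym; n≤1+n)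
open import Data.Bool using (false)
import Data.Bool as Bool
open import Data.Fin using (Fin; zero; suc; _≟_)
open import Data.Fin.Properties using (any?)
open import Data.Fin.Subset
  using (Subset; _∈_; _∉_; _⊆_; _∪_; _-_; ⁅_⁆; ∣_∣; ⊤; inside; outside)
  renaming (⊥ to ∅)
open import Data.Fin.Subset.Properties
  using (_∈?_; ∉⊥; nonempty?; Empty-unique; ∣⊥∣≡0; ∣⊤∣≡n; ∈⊤; ∣p∣≤n; ∣p∣≡n⇒p≡⊤; drop-not-there;
         x∈⁅x⁆; x∈⁅y⁆⇒x≡y; p⊆p∪q; x∈p∪q⁺; x∈p∪q⁻; ∪-identityʳ; p─⊥≡p; p─q⊆p;
         x∈p∧x≢y⇒x∈p-y)
open import Data.Vec using (_∷_; lookup; here; there)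
open import Data.Vec.Properties using (lookup⇒[]=; []=⇒lookup)
open import Data.List using (List; _∷_; []; map; filter; allFin)
open import Data.List.Membership.Propositional using () renaming (_∈_ to _∈ˡ_; _∉_ to _∉ˡ_)
open import Data.List.Membership.Propositional.Properties
  using (∈-map⁺; ∈-map⁻; ∈-filter⁺; ∈-filter⁻; ∈-allFin)
open import Data.List.Membership.DecPropositional Data.Nat._≟_ using () renaming (_∈?_ to _∈ˡ?_)
open import Data.List.Relation.Unary.Any using (here; there)
open import Data.Product using (_×_; _,_; proj₁; proj₂; ∃-syntax)
open import Data.Sum using (_⊎_; inj₁; inj₂; [_,_]′)
open import Function using (_∘_)
open import Induction.WellFounded using (Acc; acc)
open import Algebra.Bundles using (Group)
open import Algebra.Structures using (IsGroup)
import Algebra.Properties.Group as GroupProperties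
open import Level using (0ℓ)
open import Relation.Nullary using (Dec; yes; no; does; ¬_; contradiction)
open import Relation.Nullary.Decidable
  using (¬?; _×-dec_; _⊎-dec_; dec-true; dec-false; decidable-stable)
open import Relation.Binary.PropositionalEquality
  using (_≡_; _≢_; refl; sym; trans; cong; subst; module ≡-Reasoning)

private
  variable
    n : ℕ
    x : Fin n
    p q : Subset n
    xs : List ℕ

if-does-yes : ∀ {A : Set} {a b : ℕ} (a? : Dec A) → A → (Bool.if does a? then a else b) ≡ a
if-does-yes a? a = cong (Bool.if_then _ else _) (dec-true a? a)

if-does-no : ∀ {A : Set} {a b : ℕ} (a? : Dec A) → ¬ A → (Bool.if does a? then a else b) ≡ b
if-does-no a? ¬a = cong (Bool.if_then _ else _) (dec-false a? ¬a)

mex≡0 : 0 ∉ˡ xs → mex xs ≡ 0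
mex≡0 {xs} = if-does-no (0 ∈ˡ? xs)

mex≡1 : 0 ∈ˡ xs → 1 ∉ˡ xs → mex xs ≡ 1
mex≡1 {xs@(_ ∷ _)} 0∈xs 1∉xs = trans (if-does-yes (0 ∈ˡ? xs) 0∈xs) (if-does-no (1 ∈ˡ? xs) 1∉xs)

mex≡2 : 0 ∈ˡ xs → 1 ∈ˡ xs → 2 ∉ˡ xs → mex xs ≡ 2
mex≡2 {_ ∷ []} (here refl) (here ()) _
mex≡2 {_ ∷ []} (there ()) _ _
mex≡2 {xs@(_ ∷ _ ∷ _)} 0∈xs 1∈xs 2∉xs = trans (if-does-yes (0 ∈ˡ? xs) 0∈xs)
  (trans (if-does-yes (1 ∈ˡ? xs) 1∈xs) (if-does-no (2 ∈ˡ? xs) 2∉xs))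

2∣n⇒2∤1+n : ∀ {m} → 2 ∣ m → ¬ 2 ∣ suc m
2∣n⇒2∤1+n {m} 2∣m 2∣1+m with () ← ∣1⇒≡1 (∣m+n∣m⇒∣n (subst (2 ∣_) (+-comm 1 m) 2∣1+m) 2∣m)

2∤n⇒2∣1+n : ∀ {m} → ¬ 2 ∣ m → 2 ∣ suc m
2∤n⇒2∣1+n {zero}        2∤m = contradiction (2 ∣0) 2∤m
2∤n⇒2∣1+n {suc zero}    _   = ∣-refl
2∤n⇒2∣1+n {suc (suc m)} 2∤m = ∣m∣n⇒∣m+n ∣-refl (2∤n⇒2∣1+n (2∤m ∘ ∣m∣n⇒∣m+n ∣-refl))

∉⇒lookup≡false : x ∉ p → lookup p x ≡ false
∉⇒lookup≡false {x = x} {p = p} x∉p with lookup p x in eq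
... | inside  = contradiction (lookup⇒[]= x p eq) x∉p
... | outside = refl

lookup≡false⇒∉ : lookup p x ≡ false → x ∉ p
lookup≡false⇒∉ eq x∈p with () ← trans (sym ([]=⇒lookup x∈p)) eq

x∈p∪⁅x⁆ : ∀ (p : Subset n) x → x ∈ p ∪ ⁅ x ⁆
x∈p∪⁅x⁆ p x = x∈p∪q⁺ (inj₂ (x∈⁅x⁆ x))

∪⁅⁆-least : p ⊆ q → x ∈ q → p ∪ ⁅ x ⁆ ⊆ q
∪⁅⁆-least {p = p} {x = x} p⊆q x∈q y∈ with x∈p∪q⁻ p ⁅ x ⁆ y∈
... | inj₁ y∈p     = p⊆q y∈p
... | inj₂ y∈⁅x⁆ rewrite x∈⁅y⁆⇒x≡y x y∈⁅x⁆ = x∈q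

x∉p-x : ∀ (p : Subset n) x → x ∉ p - x
x∉p-x (_ ∷ _) zero    ()
x∉p-x (_ ∷ p) (suc x) (there x∈p-x) = x∉p-x p x x∈p-x

∣p∪⁅x⁆∣≡1+∣p∣ : x ∉ p → ∣ p ∪ ⁅ x ⁆ ∣ ≡ suc ∣ p ∣
∣p∪⁅x⁆∣≡1+∣p∣ {x = zero}  {p = inside  ∷ p} x∉p = contradiction here x∉p
∣p∪⁅x⁆∣≡1+∣p∣ {x = zero}  {p = outside ∷ p} x∉p = cong (suc ∘ ∣_∣) (∪-identityʳ p)
∣p∪⁅x⁆∣≡1+∣p∣ {x = suc x} {p = inside  ∷ p} x∉p = cong suc (∣p∪⁅x⁆∣≡1+∣p∣ (drop-not-there x∉p))
∣p∪⁅x⁆∣≡1+∣p∣ {x = suc x} {p = outside ∷ p} x∉p = ∣p∪⁅x⁆∣≡1+∣p∣ (drop-not-there x∉p)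

∣p∣≡1+∣p-x∣ : x ∈ p → ∣ p ∣ ≡ suc ∣ p - x ∣
∣p∣≡1+∣p-x∣ {p = inside  ∷ p} here          = cong (suc ∘ ∣_∣) (sym (p─⊥≡p p))
∣p∣≡1+∣p-x∣ {p = inside  ∷ _} (there x∈p)   = cong suc (∣p∣≡1+∣p-x∣ x∈p)
∣p∣≡1+∣p-x∣ {p = outside ∷ _} (there x∈p)   = ∣p∣≡1+∣p-x∣ x∈p

2∤∣p∣⇒2∣∣p∪⁅x⁆∣ : x ∉ p → ¬ 2 ∣ ∣ p ∣ → 2 ∣ ∣ p ∪ ⁅ x ⁆ ∣
2∤∣p∣⇒2∣∣p∪⁅x⁆∣ x∉p 2∤∣p∣ = subst (2 ∣_) (sym (∣p∪⁅x⁆∣≡1+∣p∣ x∉p)) (2∤n⇒2∣1+n 2∤∣p∣)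

2∣∣p∣⇒2∤∣p∪⁅x⁆∣ : x ∉ p → 2 ∣ ∣ p ∣ → ¬ 2 ∣ ∣ p ∪ ⁅ x ⁆ ∣
2∣∣p∣⇒2∤∣p∪⁅x⁆∣ x∉p 2∣∣p∣ = subst (λ k → ¬ 2 ∣ k) (sym (∣p∪⁅x⁆∣≡1+∣p∣ x∉p)) (2∣n⇒2∤1+n 2∣∣p∣)

n≤∣p∣⇒p≡⊤ : {p : Subset n} → n ≤ ∣ p ∣ → p ≡ ⊤
n≤∣p∣⇒p≡⊤ {p = p} n≤∣p∣ = ∣p∣≡n⇒p≡⊤ (≤-antisym (∣p∣≤n p) n≤∣p∣)

module _ (f : Fin n → Fin n) (f-involutive : ∀ x → f (f x) ≡ x) where

  fixedPointFreeInvolution⇒2∣∣p∣ : (∀ {x} → x ∈ p → f x ∈ p) → (∀ {x} → x ∈ p → f x ≢ x) →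
                                   2 ∣ ∣ p ∣
  fixedPointFreeInvolution⇒2∣∣p∣ {p = p} = go p (<-wellFounded ∣ p ∣)
    where
    go : ∀ p → Acc _<_ ∣ p ∣ → (∀ {x} → x ∈ p → f x ∈ p) → (∀ {x} → x ∈ p → f x ≢ x) →
         2 ∣ ∣ p ∣
    go p (acc rec) f-closed f-fixedPointFree with nonempty? p
    ... | no p-empty = subst (2 ∣_) (sym (trans (cong ∣_∣ (Empty-unique p-empty)) (∣⊥∣≡0 n))) (2 ∣0)
    ... | yes (x , x∈p) =
      subst (2 ∣_) (sym ∣p∣≡2+∣r∣)
        (∣m∣n⇒∣m+n ∣-refl (go r (rec ∣r∣<∣p∣) r-closed (f-fixedPointFree ∘ r⊆p)))
      where
      r : Subset _
      r = p - x - f x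

      fx∈p-x : f x ∈ p - x
      fx∈p-x = x∈p∧x≢y⇒x∈p-y (f-closed x∈p) (f-fixedPointFree x∈p)

      ∣p∣≡2+∣r∣ : ∣ p ∣ ≡ 2 + ∣ r ∣
      ∣p∣≡2+∣r∣ = trans (∣p∣≡1+∣p-x∣ x∈p) (cong suc (∣p∣≡1+∣p-x∣ fx∈p-x))

      ∣r∣<∣p∣ : ∣ r ∣ < ∣ p ∣
      ∣r∣<∣p∣ = subst (suc ∣ r ∣ ≤_) (sym ∣p∣≡2+∣r∣) (n≤1+n _)

      r⊆p-x : r ⊆ p - x
      r⊆p-x = p─q⊆p (p - x) ⁅ f x ⁆

      r⊆p : r ⊆ p
      r⊆p = p─q⊆p p ⁅ x ⁆ ∘ r⊆p-x

      r-closed : ∀ {y} → y ∈ r → f y ∈ r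
      r-closed {y} y∈r = x∈p∧x≢y⇒x∈p-y (x∈p∧x≢y⇒x∈p-y (f-closed (r⊆p y∈r)) fy≢x) fy≢fx
        where
        fy≢x : f y ≢ x
        fy≢x fy≡x = x∉p-x (p - x) (f x) (subst (_∈ r) (trans (sym (f-involutive y)) (cong f fy≡x)) y∈r)
        fy≢fx : f y ≢ f x
        fy≢fx fy≡fx = x∉p-x p x (subst (_∈ p - x) y≡x (r⊆p-x y∈r))
          where
          y≡x : y ≡ x
          y≡x = trans (sym (f-involutive y)) (trans (cong f fy≡fx) (f-involutive x))

module Generation {n} (_∙_ : Fin n → Fin n → Fin n) (ε : Fin n) (_⁻¹ : Fin n → Fin n) where

  open Game _∙_ ε _⁻¹

  ∈⟨⟩-trans : (∀ {x} → x ∈ p → x ∈⟨ q ⟩) → x ∈⟨ p ⟩ → x ∈⟨ q ⟩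
  ∈⟨⟩-trans p⊆⟨q⟩ (gen x∈p) = p⊆⟨q⟩ x∈p
  ∈⟨⟩-trans p⊆⟨q⟩ one       = one
  ∈⟨⟩-trans p⊆⟨q⟩ (mul x y) = mul (∈⟨⟩-trans p⊆⟨q⟩ x) (∈⟨⟩-trans p⊆⟨q⟩ y)
  ∈⟨⟩-trans p⊆⟨q⟩ (inv x)   = inv (∈⟨⟩-trans p⊆⟨q⟩ x)

  Generates-mono : p ⊆ q → Generates p → Generates q
  Generates-mono p⊆q p-gen x = ∈⟨⟩-trans (gen ∘ p⊆q) (p-gen x)

  Generates-∪⁅⁆⁻ : x ∈⟨ p ⟩ → Generates (p ∪ ⁅ x ⁆) → Generates p
  Generates-∪⁅⁆⁻ {x = x} {p = p} x∈⟨p⟩ p∪x-gen y = ∈⟨⟩-trans p∪x⊆⟨p⟩ (p∪x-gen y)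
    where
    p∪x⊆⟨p⟩ : ∀ {z} → z ∈ p ∪ ⁅ x ⁆ → z ∈⟨ p ⟩
    p∪x⊆⟨p⟩ z∈p∪x with x∈p∪q⁻ p ⁅ x ⁆ z∈p∪x
    ... | inj₁ z∈p    = gen z∈p
    ... | inj₂ z∈⁅x⁆ rewrite x∈⁅y⁆⇒x≡y x z∈⁅x⁆ = x∈⟨p⟩

  n≤∣p∣⇒Generates : n ≤ ∣ p ∣ → Generates p
  n≤∣p∣⇒Generates n≤∣p∣ x = gen (subst (x ∈_) (sym (n≤∣p∣⇒p≡⊤ n≤∣p∣)) ∈⊤)

  HasGeneratingMove : Subset n → Set
  HasGeneratingMove p = ∃[ g ] g ∉ p × Generates (p ∪ ⁅ g ⁆)

  HasGeneratingMove-∪⁅⁆⁺ : ¬ Generates (p ∪ ⁅ x ⁆) →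
                           HasGeneratingMove p → HasGeneratingMove (p ∪ ⁅ x ⁆)
  HasGeneratingMove-∪⁅⁆⁺ {p = p} {x = x} ¬gen (g , g∉p , p∪g-gen) with g ∈? p ∪ ⁅ x ⁆
  ... | yes g∈p∪x = contradiction (Generates-mono (∪⁅⁆-least (p⊆p∪q ⁅ x ⁆) g∈p∪x) p∪g-gen) ¬gen
  ... | no  g∉p∪x =
    g , g∉p∪x , Generates-mono (∪⁅⁆-least (p⊆p∪q ⁅ g ⁆ ∘ p⊆p∪q ⁅ x ⁆) (x∈p∪⁅x⁆ _ g)) p∪g-gen

  HasGeneratingMove-∪⁅⁆⁻ : x ∈⟨ p ⟩ → HasGeneratingMove (p ∪ ⁅ x ⁆) → HasGeneratingMove p
  HasGeneratingMove-∪⁅⁆⁻ {x = x} {p = p} x∈⟨p⟩ (g , g∉p∪x , p∪x∪g-gen) =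
    g , g∉p∪x ∘ p⊆p∪q ⁅ x ⁆ ,
    Generates-∪⁅⁆⁻ (∈⟨⟩-trans (gen ∘ p⊆p∪q ⁅ g ⁆) x∈⟨p⟩) (Generates-mono swap p∪x∪g-gen)
    where
    swap : (p ∪ ⁅ x ⁆) ∪ ⁅ g ⁆ ⊆ (p ∪ ⁅ g ⁆) ∪ ⁅ x ⁆
    swap = ∪⁅⁆-least (∪⁅⁆-least (p⊆p∪q ⁅ x ⁆ ∘ p⊆p∪q ⁅ g ⁆) (x∈p∪⁅x⁆ _ x)) (p⊆p∪q ⁅ x ⁆ (x∈p∪⁅x⁆ p g))

module GroupOfOddOrder {n} {_∙_ : Fin n → Fin n → Fin n} {ε : Fin n} {_⁻¹ : Fin n → Fin n}
                       (isGroup : IsGroup _≡_ _∙_ ε _⁻¹) where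

  open Game _∙_ ε _⁻¹
  open IsGroup isGroup using (assoc; identityˡ; identityʳ; inverseʳ)
  private
    group : Group 0ℓ 0ℓ
    group = record { isGroup = isGroup }

  open GroupProperties group
    using (ε⁻¹≈ε; ⁻¹-involutive; ⁻¹-injective; identityʳ-unique)
  open ≡-Reasoning

  ∈⟨∅⟩⇒≡ε : x ∈⟨ ∅ ⟩ → x ≡ ε
  ∈⟨∅⟩⇒≡ε (gen x∈∅) = contradiction x∈∅ ∉⊥
  ∈⟨∅⟩⇒≡ε one = refl
  ∈⟨∅⟩⇒≡ε (mul x∈ y∈) rewrite ∈⟨∅⟩⇒≡ε x∈ | ∈⟨∅⟩⇒≡ε y∈ = identityˡ ε
  ∈⟨∅⟩⇒≡ε (inv x∈) rewrite ∈⟨∅⟩⇒≡ε x∈ = ε⁻¹≈ε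

  Generates∅⇒trivial : Generates ∅ → ∀ x y → x ≡ y
  Generates∅⇒trivial ∅-gen x y = trans (∈⟨∅⟩⇒≡ε (∅-gen x)) (sym (∈⟨∅⟩⇒≡ε (∅-gen y)))

  module _ (n-odd : ¬ 2 ∣ n) where

    x⁻¹≡x⇒x≡ε : x ⁻¹ ≡ x → x ≡ ε
    x⁻¹≡x⇒x≡ε {x} x⁻¹≡x with x ≟ ε
    ... | yes x≡ε = x≡ε
    ... | no  x≢ε = contradiction (subst (2 ∣_) (∣⊤∣≡n n) 2∣∣⊤∣) n-odd
      where
      ∙x-involutive : ∀ g → (g ∙ x) ∙ x ≡ g
      ∙x-involutive g = begin
        (g ∙ x) ∙ x        ≡⟨ assoc g x x ⟩
        g ∙ (x ∙ x)        ≡⟨ cong (λ y → g ∙ (x ∙ y)) (sym x⁻¹≡x) ⟩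
        g ∙ (x ∙ (x ⁻¹))   ≡⟨ cong (g ∙_) (inverseʳ x) ⟩
        g ∙ ε              ≡⟨ identityʳ g ⟩
        g                  ∎

      2∣∣⊤∣ : 2 ∣ ∣ ⊤ {n} ∣
      2∣∣⊤∣ = fixedPointFreeInvolution⇒2∣∣p∣ (_∙ x) ∙x-involutive (λ _ → ∈⊤)
                (λ {g} _ g∙x≡g → x≢ε (identityʳ-unique g x g∙x≡g))

    ∈-and-⁻¹-closed⇒2∤∣p∣ : ε ∈ p → (∀ {x} → x ∈ p → x ⁻¹ ∈ p) → ¬ 2 ∣ ∣ p ∣
    ∈-and-⁻¹-closed⇒2∤∣p∣ {p = p} ε∈p ⁻¹-closed =
      subst (λ k → ¬ 2 ∣ k) (sym (∣p∣≡1+∣p-x∣ ε∈p)) (2∣n⇒2∤1+n 2∣∣p-ε∣)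
      where
      2∣∣p-ε∣ : 2 ∣ ∣ p - ε ∣
      2∣∣p-ε∣ = fixedPointFreeInvolution⇒2∣∣p∣ _⁻¹ ⁻¹-involutive
        (λ x∈p-ε → x∈p∧x≢y⇒x∈p-y (⁻¹-closed (p─q⊆p p ⁅ ε ⁆ x∈p-ε))
                     (λ x⁻¹≡ε → ∉p-ε (⁻¹-injective (trans x⁻¹≡ε (sym ε⁻¹≈ε))) x∈p-ε))
        (λ x∈p-ε x⁻¹≡x → ∉p-ε (x⁻¹≡x⇒x≡ε x⁻¹≡x) x∈p-ε)
        where
        ∉p-ε : ∀ {x} → x ≡ ε → x ∉ p - ε
        ∉p-ε refl = x∉p-x p ε

    2∣∣p∣⇒∃∉∈⟨⟩ : 2 ∣ ∣ p ∣ → ∃[ h ] h ∉ p × h ∈⟨ p ⟩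
    2∣∣p∣⇒∃∉∈⟨⟩ {p = p} 2∣∣p∣
      with any? (λ h → ¬? (h ∈? p) ×-dec ((h ≟ ε) ⊎-dec ((h ⁻¹) ∈? p)))
    ... | yes (h , h∉p , inj₁ refl)  = h , h∉p , one
    ... | yes (h , h∉p , inj₂ h⁻¹∈p) = h , h∉p , subst (_∈⟨ p ⟩) (⁻¹-involutive h) (inv (gen h⁻¹∈p))
    ... | no  ∄h = contradiction 2∣∣p∣ (∈-and-⁻¹-closed⇒2∤∣p∣ ε∈p ⁻¹-closed)
      where
      ε∈p : ε ∈ p
      ε∈p = decidable-stable (ε ∈? p) (λ ε∉p → ∄h (ε , ε∉p , inj₁ refl))

      ⁻¹-closed : ∀ {x} → x ∈ p → x ⁻¹ ∈ p
      ⁻¹-closed {x} x∈p = decidable-stable ((x ⁻¹) ∈? p) λ x⁻¹∉p →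
        ∄h (x ⁻¹ , x⁻¹∉p , inj₂ (subst (_∈ p) (sym (⁻¹-involutive x)) x∈p))

module NimValues {n} (_∙_ : Fin n → Fin n → Fin n) (ε : Fin n) (_⁻¹ : Fin n → Fin n)
                 (gen? : (p : Subset n) → Dec (Game.Generates _∙_ ε _⁻¹ p))
                 (2∣∣p∣⇒∃∉∈⟨⟩ : ∀ {p} → 2 ∣ ∣ p ∣ → ∃[ h ] h ∉ p × Game._∈⟨_⟩ _∙_ ε _⁻¹ h p) where

  open Game _∙_ ε _⁻¹
  open Generation _∙_ ε _⁻¹

  hasGeneratingMove? : (p : Subset n) → Dec (HasGeneratingMove p)
  hasGeneratingMove? p = any? (λ g → ¬? (g ∈? p) ×-dec gen? (p ∪ ⁅ g ⁆))

  nim : ℕ → Subset n → ℕ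
  nim = nimF gen?

  optionValues : ℕ → Subset n → List ℕ
  optionValues f p =
    map (λ g → nim f (p ∪ ⁅ g ⁆)) (filter (λ g → lookup p g Bool.≟ false) (allFin n))

  nim-generating : ∀ f → Generates p → nim f p ≡ 0
  nim-generating {p = p} f p-gen with gen? p
  ... | yes _    = refl
  ... | no ¬gen = contradiction p-gen ¬gen

  nim-suc : ∀ f → ¬ Generates p → nim (suc f) p ≡ mex (optionValues f p)
  nim-suc {p = p} f ¬gen with gen? p
  ... | yes p-gen = contradiction p-gen ¬gen
  ... | no _      = refl

  nim-by-cases : ∀ f p {R : ℕ → Set} →
                 (Generates p → R 0) → (¬ Generates p → R (nim f p)) → R (nim f p)
  nim-by-cases f p {R} generating non-generating = by-cases (gen? p)
    where
    by-cases : Dec (Generates p) → R (nim f p)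
    by-cases (yes p-gen) = subst R (sym (nim-generating f p-gen)) (generating p-gen)
    by-cases (no ¬gen)   = non-generating ¬gen

  ∈-optionValues : ∀ f {g} → g ∉ p → nim f (p ∪ ⁅ g ⁆) ∈ˡ optionValues f p
  ∈-optionValues {p = p} f {g} g∉p =
    ∈-map⁺ _ (∈-filter⁺ (λ g → lookup p g Bool.≟ false) (∈-allFin g) (∉⇒lookup≡false g∉p))

  ∉-optionValues : ∀ f {k} → (∀ {g} → g ∉ p → nim f (p ∪ ⁅ g ⁆) ≢ k) → k ∉ˡ optionValues f p
  ∉-optionValues {p = p} f option≢k k∈ with ∈-map⁻ _ k∈
  ... | g , g∈ , k≡ = option≢k g∉p (sym k≡)
    where
    g∉p : g ∉ p
    g∉p = lookup≡false⇒∉ (proj₂ (∈-filter⁻ (λ g → lookup p g Bool.≟ false) {xs = allFin n} g∈))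

  OddValue : Subset n → ℕ → Set
  OddValue p v = HasGeneratingMove p × v ≡ 1 ⊎ ¬ HasGeneratingMove p × v ≡ 0

  EvenValue : Subset n → ℕ → Set
  EvenValue p v = (v ≡ 1 ⊎ v ≡ 2) × (HasGeneratingMove p → v ≡ 2)

  enough-fuel : ∀ {f g} → n ≤ ∣ p ∣ + suc f → g ∉ p → n ≤ ∣ p ∪ ⁅ g ⁆ ∣ + f
  enough-fuel {p = p} {f} n≤ g∉p rewrite ∣p∪⁅x⁆∣≡1+∣p∣ g∉p = subst (n ≤_) (+-suc ∣ p ∣ f) n≤

  no-fuel-left : n ≤ ∣ p ∣ + 0 → Generates p
  no-fuel-left {p = p} n≤ = n≤∣p∣⇒Generates (subst (n ≤_) (+-identityʳ ∣ p ∣) n≤)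

  -- The hypothesis n ≤ ∣ p ∣ + f says that the fuel f of nimF covers every move left from p.
  mutual
    nim-odd : ∀ f p → n ≤ ∣ p ∣ + f → ¬ Generates p → ¬ 2 ∣ ∣ p ∣ → OddValue p (nim f p)
    nim-odd zero    p n≤ ¬gen _     = contradiction (no-fuel-left n≤) ¬gen
    nim-odd (suc f) p n≤ ¬gen p-odd rewrite nim-suc f ¬gen = value (hasGeneratingMove? p)
      where
      even-option : ∀ {h} → h ∉ p → ¬ Generates (p ∪ ⁅ h ⁆) →
                    EvenValue (p ∪ ⁅ h ⁆) (nim f (p ∪ ⁅ h ⁆))
      even-option h∉p ¬gen′ = nim-even f _ (enough-fuel n≤ h∉p) ¬gen′ (2∤∣p∣⇒2∣∣p∪⁅x⁆∣ h∉p p-odd)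

      value : Dec (HasGeneratingMove p) → OddValue p (mex (optionValues f p))
      value (yes move@(g , g∉p , p∪g-gen)) =
        inj₁ (move , mex≡1 (subst (_∈ˡ _) (nim-generating f p∪g-gen) (∈-optionValues f g∉p))
                           (∉-optionValues f option≢1))
        where
        option≢1 : ∀ {h} → h ∉ p → nim f (p ∪ ⁅ h ⁆) ≢ 1
        option≢1 {h} h∉p = nim-by-cases f (p ∪ ⁅ h ⁆) {_≢ 1} (λ _ ()) λ ¬gen′ →
          subst (_≢ 1) (sym (proj₂ (even-option h∉p ¬gen′) (HasGeneratingMove-∪⁅⁆⁺ ¬gen′ move))) λ ()
      value (no ¬move) = inj₂ (¬move , mex≡0 (∉-optionValues f option≢0))
        where
        option≢0 : ∀ {h} → h ∉ p → nim f (p ∪ ⁅ h ⁆) ≢ 0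
        option≢0 {h} h∉p = nim-by-cases f (p ∪ ⁅ h ⁆) {_≢ 0} (λ gen′ _ → ¬move (h , h∉p , gen′)) λ ¬gen′ →
          [ (λ v≡1 → subst (_≢ 0) (sym v≡1) λ ()) , (λ v≡2 → subst (_≢ 0) (sym v≡2) λ ()) ]′
            (proj₁ (even-option h∉p ¬gen′))

    nim-even : ∀ f p → n ≤ ∣ p ∣ + f → ¬ Generates p → 2 ∣ ∣ p ∣ → EvenValue p (nim f p)
    nim-even zero    p n≤ ¬gen _      = contradiction (no-fuel-left n≤) ¬gen
    nim-even (suc f) p n≤ ¬gen p-even rewrite nim-suc f ¬gen =
      let h , h∉p , h∈⟨p⟩ = 2∣∣p∣⇒∃∉∈⟨⟩ p-even
      in value h∉p h∈⟨p⟩ (odd-option h∉p (¬gen ∘ Generates-∪⁅⁆⁻ h∈⟨p⟩))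
      where
      odd-option : ∀ {h} → h ∉ p → ¬ Generates (p ∪ ⁅ h ⁆) →
                   OddValue (p ∪ ⁅ h ⁆) (nim f (p ∪ ⁅ h ⁆))
      odd-option h∉p ¬gen′ = nim-odd f _ (enough-fuel n≤ h∉p) ¬gen′ (2∣∣p∣⇒2∤∣p∪⁅x⁆∣ h∉p p-even)

      option≢2 : ∀ {h} → h ∉ p → nim f (p ∪ ⁅ h ⁆) ≢ 2
      option≢2 {h} h∉p = nim-by-cases f (p ∪ ⁅ h ⁆) {_≢ 2} (λ _ ()) λ ¬gen′ →
        [ (λ (_ , v≡1) → subst (_≢ 2) (sym v≡1) λ ()) , (λ (_ , v≡0) → subst (_≢ 2) (sym v≡0) λ ()) ]′
          (odd-option h∉p ¬gen′)

      value≡2 : 0 ∈ˡ optionValues f p → 1 ∈ˡ optionValues f p →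
                EvenValue p (mex (optionValues f p))
      value≡2 0∈ 1∈ = inj₂ mex≡2′ , λ _ → mex≡2′
        where
        mex≡2′ : mex (optionValues f p) ≡ 2
        mex≡2′ = mex≡2 0∈ 1∈ (∉-optionValues f option≢2)

      value : ∀ {h} → h ∉ p → h ∈⟨ p ⟩ → OddValue (p ∪ ⁅ h ⁆) (nim f (p ∪ ⁅ h ⁆)) →
              EvenValue p (mex (optionValues f p))
      value h∉p h∈⟨p⟩ (inj₁ (move′ , v≡1)) =
        let g , g∉p , gen′ = HasGeneratingMove-∪⁅⁆⁻ h∈⟨p⟩ move′
        in value≡2 (subst (_∈ˡ _) (nim-generating f gen′) (∈-optionValues f g∉p))
                   (subst (_∈ˡ _) v≡1 (∈-optionValues f h∉p))
      value h∉p h∈⟨p⟩ (inj₂ (¬move′ , v≡0)) =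
        value′ (subst (_∈ˡ _) v≡0 (∈-optionValues f h∉p)) (1 ∈ˡ? optionValues f p)
        where
        value′ : 0 ∈ˡ optionValues f p → Dec (1 ∈ˡ optionValues f p) →
                 EvenValue p (mex (optionValues f p))
        value′ 0∈ (yes 1∈) = value≡2 0∈ 1∈
        value′ 0∈ (no 1∉)  = inj₁ (mex≡1 0∈ 1∉) , λ move →
          contradiction (HasGeneratingMove-∪⁅⁆⁺ (¬gen ∘ Generates-∪⁅⁆⁻ h∈⟨p⟩) move) ¬move′

corollary4p8 : (n : ℕ) (_∙_ : Fin n → Fin n → Fin n) (ε : Fin n) (_⁻¹ : Fin n → Fin n) →
    IsGroup _≡_ _∙_ ε _⁻¹ → 2 ≤ n → ¬ (2 ∣ n) →
    (gen? : (P : Subset n) → Dec (Game.Generates _∙_ ε _⁻¹ P)) →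
    Game.nimGEN _∙_ ε _⁻¹ gen? ≡ 1 ⊎ Game.nimGEN _∙_ ε _⁻¹ gen? ≡ 2
corollary4p8 zero          _ _ _ _ () _ _
corollary4p8 (suc zero)    _ _ _ _ (s≤s ()) _ _
corollary4p8 n@(suc (suc _)) _∙_ ε _⁻¹ isGroup _ n-odd gen? =
  proj₁ (nim-even n ∅ n≤∣∅∣+n ¬Generates∅ (subst (2 ∣_) (sym (∣⊥∣≡0 n)) (2 ∣0)))
  where
  open GroupOfOddOrder isGroup
  open NimValues _∙_ ε _⁻¹ gen? (2∣∣p∣⇒∃∉∈⟨⟩ n-odd)

  n≤∣∅∣+n : n ≤ ∣ ∅ {n} ∣ + n
  n≤∣∅∣+n = subst (λ k → n ≤ k + n) (sym (∣⊥∣≡0 n)) ≤-refl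

  ¬Generates∅ : ¬ Game.Generates _∙_ ε _⁻¹ (∅ {n})
  ¬Generates∅ ∅-gen with () ← Generates∅⇒trivial ∅-gen zero (suc zero)
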